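{- There is no finite complete axiomatization for functional dependencies, unary marginal identities and unary marginal distribution equivalences. More precisely, for every natural number $k$, no set of sound axioms each of which is at most $k$-ary is complete for the implication problem for FDs, UMIs and UMDEs (i.e. there is a finite set $\Sigma\cup\{\sigma\}$ of such atoms with $\Sigma\models\sigma$ but $\sigma$ not derivable from $\Sigma$).
   Context: A probabilistic team is a function $\mathbb{X}\colon X\to(0,1]$ with $\sum_{s\in X}\mathbb{X}(s)=1$, where $X$ is a finite set of assignments $s\colon D\to A$ of values to a finite set $D$ of variables; $|\mathbb{X}_{x=a}|=\sum_{s(x)=a}\mathbb{X}(s)$ and $X(x)=\{s(x)\mid s\in X\}$. Atoms: FDs $=\!(\bar{x},\bar{y})$ (tuples of variables, $\bar{x}$ possibly empty), satisfied iff assignments agreeing on $\bar{x}$ agree on $\bar{y}$; UMIs $x\approx y$, satisfied iff $|\mathbb{X}_{x=a}|=|\mathbb{X}_{y=a}|$ for all $a$; UMDEs $x\approx^* y$, satisfied iff the multisets $\{\{|\mathbb{X}_{x=a}|\mid a\in X(x)\}\}$ and $\{\{|\mathbb{X}_{y=a}|\mid a\in X(y)\}\}$ are equal. $\Sigma\models\sigma$ means every probabilistic team satisfying $\Sigma$ satisfies $\sigma$. An axiom is a rule schema "from $\sigma_1,\dots,\sigma_m$ infer $\delta_1,\dots,\delta_l$"; it is $k$-ary if $m\le k$, and sound if it preserves satisfaction in every probabilistic team. An axiomatization is complete if $\Sigma\models\sigma$ implies that $\sigma$ is derivable from $\Sigma$ by its axioms. A finite axiomatization is $k$-ary for some $k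$.
   Formalization: Probabilistic teams take rational weights in (0,1] rather than real ones, so soundness of axioms and the implication Σ ⊨ σ both range over rational-weighted teams. -}

module Defs where

open import Level using (Level)
open import Data.Nat as ℕ using (ℕ; _≤_)
open import Data.Rational as ℚ using (ℚ; 0ℚ; 1ℚ; _+_; _<_)
open import Data.List using (List; []; _∷_; map; foldr; filter; deduplicate; length)
open import Data.List.Relation.Unary.All using (All)
open import Data.List.Membership.Propositional using (_∈_)
open import Data.List.Relation.Binary.Permutation.Propositional using (_↭_)
open import Data.Product using (_×_; _,_; proj₁; proj₂; Σ-syntax)
open import Relation.Binary.PropositionalEquality using (_≡_)
open import Relation.Nullary using (¬_)

Var : Set
Var = ℕ

Val : Set
Val = ℕ

Assignment : Set
Assignment = Var → Val

record Team : Set where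
  field
    entries : List (Assignment × ℚ)
    positive : All (λ e → 0ℚ < proj₂ e) entries
    total : foldr _+_ 0ℚ (map proj₂ entries) ≡ 1ℚ
open Team public

sumℚ : List ℚ → ℚ
sumℚ = foldr _+_ 0ℚ

mass : Team → Var → Val → ℚ
mass T x a = sumℚ (map proj₂ (filter (λ e → proj₁ e x ℕ.≟ a) (entries T)))

values : Team → Var → List Val
values T x = deduplicate ℕ._≟_ (map (λ e → proj₁ e x) (entries T))

data Atom : Set where
  fd   : List Var → List Var → Atom
  umi  : Var → Var → Atom
  umde : Var → Var → Atom

Sat : Team → Atom → Set
Sat T (fd xs ys) =
  ∀ s t → s ∈ entries T → t ∈ entries T →
    All (λ x → proj₁ s x ≡ proj₁ t x) xs →
    All (λ y → proj₁ s y ≡ proj₁ t y) ys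
Sat T (umi x y) = ∀ a → mass T x a ≡ mass T y a
Sat T (umde x y) = map (mass T x) (values T x) ↭ map (mass T y) (values T y)

SatAll : Team → List Atom → Set
SatAll T Σ = All (Sat T) Σ

_⊨_ : List Atom → Atom → Set
Σ ⊨ σ = ∀ T → SatAll T Σ → Sat T σ

Instance : Set
Instance = List Atom × List Atom

-- An axiom (rule schema) is identified with its set of instances.
Axiom : Set₁
Axiom = Instance → Set

Sound : Axiom → Set
Sound r = ∀ prem concl → r (prem , concl) → ∀ T → SatAll T prem → SatAll T concl

KAry : ℕ → Axiom → Set
KAry k r = ∀ prem concl → r (prem , concl) → length prem ≤ k

Axiomatization : Set₂
Axiomatization = Axiom → Set₁

data Derivable (Ax : Axiomatization) (Σ : List Atom) : Atom → Set₁ where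
  hyp : ∀ {σ} → σ ∈ Σ → Derivable Ax Σ σ
  app : ∀ {δ} (r : Axiom) → Ax r → (prem concl : List Atom) →
        r (prem , concl) → All (Derivable Ax Σ) prem → δ ∈ concl →
        Derivable Ax Σ δ

-- Take n = k + 1 links x⟨ i ⟩ → y⟨ i ⟩ and y⟨ i ⟩ ≈* x⟨ i + 1 mod n ⟩ as Γ and σ = y⟨ 0 ⟩ → x⟨ 0 ⟩.
-- An FD x → y gives |X(y)| ≤ |X(x)| and a UMDE equates the two counts, so around the
-- cycle all counts are equal; then x⟨ 0 ⟩ → y⟨ 0 ⟩ induces a bijection of values and
-- y⟨ 0 ⟩ → x⟨ 0 ⟩ holds.  For non-derivability call an atom basic if it follows from Γ by
-- reflexivity, projection or a single link.  At most k premises leave some UMDE link j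
-- unused, and every non-basic atom fails in a team satisfying all basic atoms except
-- link j: a one-row team for UMIs, otherwise a four-row team whose columns are constant
-- or one of two independent fair bits, chosen by the position along the cycle cut at j.
-- So sound k-ary axioms only derive basic atoms from basic ones, and σ is not basic.

module Submission where

open import Defs
open import Data.Bool using (Bool; true; false; if_then_else_)
open import Data.List using (List; []; _∷_; map; length; upTo; deduplicate; filter)
open import Data.List.Properties using (map-cong; length-map; length-upTo; length-removeAt′)
open import Data.List.Membership.Propositional using (_∈_; _∉_; find)
open import Data.List.Membership.Propositional.Properties
  using (∈-map⁺; ∈-map⁻; ∈-deduplicate⁺; ∈-deduplicate⁻; ∈-upTo⁻)
open import Data.List.Relation.Binary.Subset.Propositional using (_⊆_)
open import Data.List.Relation.Binary.Permutation.Propositional using (_↭_; ↭-refl)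
open import Data.List.Relation.Binary.Permutation.Propositional.Properties using (↭-length)
open import Data.List.Relation.Unary.All as All using (All; []; _∷_; all?)
open import Data.List.Relation.Unary.All.Properties using (¬All⇒Any¬)
open import Data.List.Relation.Unary.Any as Any using (Any; here; there; index; _─_)
open import Data.List.Relation.Unary.Unique.Propositional using (Unique; []; _∷_)
open import Data.List.Relation.Unary.Unique.Propositional.Properties using (upTo⁺)
open import Data.Nat using (ℕ; zero; suc; _≤_; _<_; z≤n; s≤s; _≟_; _≡ᵇ_; _%_; _/_; _+_; _∸_)
open import Data.Nat.DivMod using (n%n≡0; m<n⇒m%n≡m; m%n<n)
open import Data.Nat.Properties
  using (_<?_; suc-injective; ≤-refl; ≤-trans; ≤-pred; <-trans; <-irrefl; <-cmp; <⇒≤; <⇒≱; ≮⇒≥;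
         ≤-<-trans; <-≤-trans; n<1+n; m<n⇒m<1+n; m≤n⇒m≤1+n; m≤n⇒m<n∨m≡n; m≤m+n;
         +-suc; +-identityʳ; +-cancelˡ-≡; +-monoʳ-<; m∸n≤m; m∸n+n≡m; +-∸-assoc; ∸-monoˡ-<;
         module ≤-Reasoning)
open import Data.List.Membership.DecPropositional _≟_ using (_∈?_)
open import Data.List.Relation.Unary.Unique.DecPropositional.Properties _≟_ using (deduplicate-!)
open import Data.Product using (_×_; _,_; proj₁; proj₂; ∃-syntax; Σ-syntax)
open import Data.Integer using (+_)
open import Data.Rational as ℚ using (ℚ; 0ℚ; 1ℚ; ½)
open import Data.Sum using (_⊎_; inj₁; inj₂)
open import Function using (_∘_)
open import Relation.Binary.Definitions using (DecidableEquality; tri<; tri≈; tri>)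
open import Relation.Binary.PropositionalEquality
open import Relation.Nullary using (¬_; yes; no; does; contradiction)
open import Relation.Nullary.Decidable using (toWitness; dec-true; dec-false)

module _ {A : Set} where

  ∈-─ : ∀ {x y : A} {xs} (x∈xs : x ∈ xs) → y ∈ xs → y ≢ x → y ∈ (xs ─ x∈xs)
  ∈-─ (here refl) (here refl)   y≢x = contradiction refl y≢x
  ∈-─ (here refl) (there y∈xs)  _   = y∈xs
  ∈-─ (there _)   (here refl)   _   = here refl
  ∈-─ (there x∈xs) (there y∈xs) y≢x = there (∈-─ x∈xs y∈xs y≢x)

  length-─ : ∀ {x : A} {xs} (x∈xs : x ∈ xs) → length xs ≡ suc (length (xs ─ x∈xs))
  length-─ {xs = xs} x∈xs = length-removeAt′ xs (index x∈xs)

  Unique-⊆⇒length≤ : ∀ {xs ys : List A} → Unique xs → xs ⊆ ys → length xs ≤ length ys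
  Unique-⊆⇒length≤ [] _ = z≤n
  Unique-⊆⇒length≤ {x ∷ xs} {ys} (x∉xs ∷ !xs) xs⊆ys = begin
    suc (length xs)           ≤⟨ s≤s (Unique-⊆⇒length≤ !xs xs⊆ys─x) ⟩
    suc (length (ys ─ x∈ys))  ≡⟨ length-─ x∈ys ⟨
    length ys                 ∎
    where
    open ≤-Reasoning
    x∈ys = xs⊆ys (here refl)
    xs⊆ys─x : xs ⊆ (ys ─ x∈ys)
    xs⊆ys─x z∈xs = ∈-─ x∈ys (xs⊆ys (there z∈xs)) (≢-sym (All.lookup x∉xs z∈xs))

module _ {A B : Set} (_≟ᴬ_ : DecidableEquality A) where

  Unique-⊆-map⇒injectiveOn : ∀ {f : A → B} {xs ys} → Unique ys → ys ⊆ map f xs →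
    length xs ≤ length ys → ∀ {a b} → a ∈ xs → b ∈ xs → f a ≡ f b → a ≡ b
  Unique-⊆-map⇒injectiveOn {f} {xs} {ys} !ys ys⊆fxs |xs|≤|ys| {a} {b} a∈xs b∈xs fa≡fb
    with a ≟ᴬ b
  ... | yes a≡b = a≡b
  ... | no a≢b = contradiction |xs|≤|ys| (<⇒≱ (begin-strict
    length ys                   ≤⟨ Unique-⊆⇒length≤ !ys ys⊆fxs─b ⟩
    length (map f (xs ─ b∈xs))  ≡⟨ length-map f (xs ─ b∈xs) ⟩
    length (xs ─ b∈xs)          <⟨ n<1+n _ ⟩
    suc (length (xs ─ b∈xs))    ≡⟨ length-─ b∈xs ⟨
    length xs                   ∎))
    where
    open ≤-Reasoning
    ys⊆fxs─b : ys ⊆ map f (xs ─ b∈xs)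
    ys⊆fxs─b z∈ys with ∈-map⁻ f (ys⊆fxs z∈ys)
    ... | c , c∈xs , refl with c ≟ᴬ b
    ...   | yes refl = subst (_∈ map f (xs ─ b∈xs)) fa≡fb (∈-map⁺ f (∈-─ b∈xs a∈xs a≢b))
    ...   | no c≢b   = ∈-map⁺ f (∈-─ b∈xs c∈xs c≢b)

∃∉-below : ∀ m (xs : List ℕ) → length xs < m → ∃[ j ] j < m × j ∉ xs
∃∉-below m xs |xs|<m with all? (_∈? xs) (upTo m)
... | yes upTo⊆xs = contradiction
      (subst (_≤ length xs) (length-upTo m) (Unique-⊆⇒length≤ (upTo⁺ m) (All.lookup upTo⊆xs)))
      (<⇒≱ |xs|<m)
... | no upTo⊈xs with j , j∈ , j∉xs ← find (¬All⇒Any¬ (_∈? xs) (upTo m) upTo⊈xs) =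
      j , ∈-upTo⁻ j∈ , j∉xs

#values : Team → Var → ℕ
#values T x = length (values T x)

∈-values⁺ : ∀ T x {e} → e ∈ entries T → proj₁ e x ∈ values T x
∈-values⁺ T x e∈T = ∈-deduplicate⁺ _≟_ (∈-map⁺ (λ e → proj₁ e x) e∈T)

∈-values⁻ : ∀ T x {a} → a ∈ values T x → ∃[ e ] e ∈ entries T × a ≡ proj₁ e x
∈-values⁻ T x a∈ = ∈-map⁻ (λ e → proj₁ e x) (∈-deduplicate⁻ _≟_ (map (λ e → proj₁ e x) (entries T)) a∈)

values-unique : ∀ T x → Unique (values T x)
values-unique T x = deduplicate-! (map (λ e → proj₁ e x) (entries T))

umde⇒#values≡ : ∀ T x y → Sat T (umde x y) → #values T x ≡ #values T y
umde⇒#values≡ T x y x≈*y = begin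
  length (values T x)                   ≡⟨ length-map (mass T x) (values T x) ⟨
  length (map (mass T x) (values T x))  ≡⟨ ↭-length x≈*y ⟩
  length (map (mass T y) (values T y))  ≡⟨ length-map (mass T y) (values T y) ⟩
  length (values T y)                   ∎
  where open ≡-Reasoning

module _ (x y : Var) where

  FunctionalOn : List (Assignment × ℚ) → Set
  FunctionalOn es = ∀ {s t} → s ∈ es → t ∈ es → proj₁ s x ≡ proj₁ t x → proj₁ s y ≡ proj₁ t y

  graphLookup : List (Assignment × ℚ) → Val → Val
  graphLookup [] a = 0
  graphLookup ((s , _) ∷ es) a with s x ≟ a
  ... | yes _ = s y
  ... | no _  = graphLookup es a

  graphLookup-correct : ∀ {es e} → FunctionalOn es → e ∈ es → graphLookup es (proj₁ e x) ≡ proj₁ e y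
  graphLookup-correct {(s , q) ∷ es} {e} fun e∈ with s x ≟ proj₁ e x | e∈
  ... | yes sx≡ex | _        = fun (here refl) e∈ sx≡ex
  ... | no sx≢ex  | here refl = contradiction refl sx≢ex
  ... | no _      | there e∈es = graphLookup-correct (λ s∈ t∈ → fun (there s∈) (there t∈)) e∈es

  module _ (T : Team) where

    fd⇒FunctionalOn : Sat T (fd (x ∷ []) (y ∷ [])) → FunctionalOn (entries T)
    fd⇒FunctionalOn x→y s∈ t∈ sx≡tx = All.head (x→y _ _ s∈ t∈ (sx≡tx ∷ []))

    values⊆map-graphLookup : FunctionalOn (entries T) →
      values T y ⊆ map (graphLookup (entries T)) (values T x)
    values⊆map-graphLookup fun b∈ with e , e∈T , refl ← ∈-values⁻ T y b∈ =
      subst (_∈ map (graphLookup (entries T)) (values T x)) (graphLookup-correct fun e∈T)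
            (∈-map⁺ (graphLookup (entries T)) (∈-values⁺ T x e∈T))

    fd⇒#values≤ : Sat T (fd (x ∷ []) (y ∷ [])) → #values T y ≤ #values T x
    fd⇒#values≤ x→y = subst (#values T y ≤_) (length-map (graphLookup (entries T)) (values T x))
      (Unique-⊆⇒length≤ (values-unique T y) (values⊆map-graphLookup (fd⇒FunctionalOn x→y)))

    -- x → y makes the graph lookup a surjection from X(x) onto X(y), so if
    -- |X(x)| ≤ |X(y)| it is a bijection and y → x holds as well.
    fd-converse : Sat T (fd (x ∷ []) (y ∷ [])) → #values T x ≤ #values T y → Sat T (fd (y ∷ []) (x ∷ []))
    fd-converse x→y |x|≤|y| s t s∈ t∈ (sy≡ty ∷ []) =
      Unique-⊆-map⇒injectiveOn _≟_ (values-unique T y) (values⊆map-graphLookup fun) |x|≤|y|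
        (∈-values⁺ T x s∈) (∈-values⁺ T x t∈)
        (trans (graphLookup-correct fun s∈) (trans sy≡ty (sym (graphLookup-correct fun t∈))))
      ∷ []
      where fun = fd⇒FunctionalOn x→y

fd-∷⁻ : ∀ T {X v Y} → Sat T (fd X (v ∷ Y)) → Sat T (fd X (v ∷ [])) × Sat T (fd X Y)
fd-∷⁻ T X→vY = (λ s t s∈ t∈ agree → All.head (X→vY s t s∈ t∈ agree) ∷ [])
             , (λ s t s∈ t∈ agree → All.tail (X→vY s t s∈ t∈ agree))

fd-from-links : ∀ T {P : Var → Var → Set} → (∀ {u v} → P u v → Sat T (fd (u ∷ []) (v ∷ []))) →
  ∀ {X Y} → All (λ v → v ∈ X ⊎ Any (λ u → P u v) X) Y → Sat T (fd X Y)
fd-from-links T {P} P⇒fd {X} determined s t s∈ t∈ agree = All.map agree-on determined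
  where
  via : ∀ {v X'} → Any (λ u → P u v) X' → All (λ u → proj₁ s u ≡ proj₁ t u) X' → proj₁ s v ≡ proj₁ t v
  via (here Puv)  (su≡tu ∷ _) = All.head (P⇒fd Puv s t s∈ t∈ (su≡tu ∷ []))
  via (there any) (_ ∷ agree') = via any agree'
  agree-on : ∀ {v} → v ∈ X ⊎ Any (λ u → P u v) X → proj₁ s v ≡ proj₁ t v
  agree-on (inj₁ v∈X) = All.lookup agree v∈X
  agree-on (inj₂ any) = via any agree

-- The variables x⟨ i ⟩ and y⟨ i ⟩ of the construction are 2i and 2i + 1.
var : ℕ → Bool → Var
var zero false = 0
var zero true  = 1
var (suc i) b = suc (suc (var i b))

varIndex : Var → ℕ
varIndex 0 = 0
varIndex 1 = 0
varIndex (suc (suc v)) = suc (varIndex v)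

varSide : Var → Bool
varSide 0 = false
varSide 1 = true
varSide (suc (suc v)) = varSide v

varIndex-var : ∀ i b → varIndex (var i b) ≡ i
varIndex-var zero false = refl
varIndex-var zero true  = refl
varIndex-var (suc i) b = cong suc (varIndex-var i b)

varSide-var : ∀ i b → varSide (var i b) ≡ b
varSide-var zero false = refl
varSide-var zero true  = refl
varSide-var (suc i) b = varSide-var i b

var-varIndex-varSide : ∀ v → var (varIndex v) (varSide v) ≡ v
var-varIndex-varSide 0 = refl
var-varIndex-varSide 1 = refl
var-varIndex-varSide (suc (suc v)) = cong (suc ∘ suc) (var-varIndex-varSide v)

x⟨_⟩ y⟨_⟩ : ℕ → Var
x⟨ i ⟩ = var i false
y⟨ i ⟩ = var i true

x-or-y : ∀ v → v ≡ x⟨ varIndex v ⟩ ⊎ v ≡ y⟨ varIndex v ⟩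
x-or-y v with varSide v | var-varIndex-varSide v
... | false | eq = inj₁ (sym eq)
... | true  | eq = inj₂ (sym eq)

x⟨⟩-injective : ∀ {i i'} → x⟨ i ⟩ ≡ x⟨ i' ⟩ → i ≡ i'
x⟨⟩-injective {i} {i'} eq = trans (sym (varIndex-var i false)) (trans (cong varIndex eq) (varIndex-var i' false))

x≢y : ∀ i i' → x⟨ i ⟩ ≢ y⟨ i' ⟩
x≢y i i' x≡y with () ← trans (sym (varSide-var i false)) (trans (cong varSide x≡y) (varSide-var i' true))

massOf : List (Val × ℚ) → Val → ℚ
massOf ps a = sumℚ (map proj₂ (filter (λ p → proj₁ p ≟ a) ps))

columnOf : Var → List (Assignment × ℚ) → List (Val × ℚ)
columnOf x = map (λ e → proj₁ e x , proj₂ e)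

mass≡massOf-columnOf : ∀ T x a → mass T x a ≡ massOf (columnOf x (entries T)) a
mass≡massOf-columnOf T x a = go (entries T)
  where
  go : ∀ es → sumℚ (map proj₂ (filter (λ e → proj₁ e x ≟ a) es)) ≡ massOf (columnOf x es) a
  go [] = refl
  -- The filter is stuck on _≡ᵇ_, which is what _≟_ on ℕ computes with.
  go ((s , q) ∷ es) with s x ≡ᵇ a
  ... | true  = cong (q ℚ.+_) (go es)
  ... | false = go es

-- Four equally likely rows, on which halves and parity are independent fair bits.
data Shape : Set where
  flat halves parity : Shape

column : Shape → ℕ → Val
column flat   _ = 0
column halves r = r / 2
column parity r = r % 2

isFlat : Shape → Bool
isFlat flat = true
isFlat _    = false

¼ : ℚ
¼ = + 1 ℚ./ 4

rows : List ℕ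
rows = 0 ∷ 1 ∷ 2 ∷ 3 ∷ []

gridTeam : (Var → Shape) → Team
gridTeam τ = record
  { entries  = map (λ r → (λ v → column (τ v) r) , ¼) rows
  ; positive = 0<¼ ∷ 0<¼ ∷ 0<¼ ∷ 0<¼ ∷ []
  ; total    = refl
  }
  where 0<¼ = toWitness {a? = 0ℚ ℚ.<? ¼} _

profile : Bool → List ℚ
profile true  = 1ℚ ∷ []
profile false = ½ ∷ ½ ∷ []

grid-profile : ∀ τ v → map (mass (gridTeam τ) v) (values (gridTeam τ) v) ≡ profile (isFlat (τ v))
grid-profile τ v = trans (map-cong (mass≡massOf-columnOf (gridTeam τ) v) (values (gridTeam τ) v)) (shape-profile (τ v))
  where
  shape-profile : ∀ s → map (massOf (map (λ r → column s r , ¼) rows)) (deduplicate _≟_ (map (column s) rows))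
                        ≡ profile (isFlat s)
  shape-profile flat   = refl
  shape-profile halves = refl
  shape-profile parity = refl

module _ (τ : Var → Shape) where

  grid-umde : ∀ {u v} → isFlat (τ u) ≡ isFlat (τ v) → Sat (gridTeam τ) (umde u v)
  grid-umde {u} {v} eq = subst₂ _↭_ (sym (grid-profile τ u)) (sym (grid-profile τ v))
                                  (subst (λ b → profile (isFlat (τ u)) ↭ profile b) eq ↭-refl)

  grid-umde⁻ : ∀ {u v} → Sat (gridTeam τ) (umde u v) → isFlat (τ u) ≡ isFlat (τ v)
  grid-umde⁻ {u} {v} u≈*v = profile-length-injective (isFlat (τ u)) (isFlat (τ v))
    (↭-length (subst₂ _↭_ (grid-profile τ u) (grid-profile τ v) u≈*v))
    where
    profile-length-injective : ∀ b b' → length (profile b) ≡ length (profile b') → b ≡ b'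
    profile-length-injective true  true  _ = refl
    profile-length-injective false false _ = refl

  ∈-gridTeam⁻ : ∀ {e} → e ∈ entries (gridTeam τ) → ∃[ r ] e ≡ ((λ w → column (τ w) r) , ¼)
  ∈-gridTeam⁻ (here refl)                         = 0 , refl
  ∈-gridTeam⁻ (there (here refl))                 = 1 , refl
  ∈-gridTeam⁻ (there (there (here refl)))         = 2 , refl
  ∈-gridTeam⁻ (there (there (there (here refl)))) = 3 , refl

  grid-fd₁ : ∀ {u v} → τ v ≡ flat ⊎ τ v ≡ τ u → Sat (gridTeam τ) (fd (u ∷ []) (v ∷ []))
  grid-fd₁ {u} {v} v-ok s t s∈ t∈ (su≡tu ∷ [])
    with r , refl ← ∈-gridTeam⁻ s∈ | r' , refl ← ∈-gridTeam⁻ t∈ = determined v-ok ∷ []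
    where
    determined : τ v ≡ flat ⊎ τ v ≡ τ u → column (τ v) r ≡ column (τ v) r'
    determined (inj₁ τv≡flat) rewrite τv≡flat = refl
    determined (inj₂ τv≡τu)   rewrite τv≡τu   = su≡tu

  -- Rows 0 and 2 agree on every column except the halves ones.
  grid-¬fd : ∀ {X Y v} → v ∈ Y → τ v ≡ halves → All (λ u → τ u ≢ halves) X → ¬ Sat (gridTeam τ) (fd X Y)
  grid-¬fd {X} {v = v} v∈Y τv≡halves X-not-halves X→Y =
    row0≢row2 (All.lookup (X→Y _ _ (here refl) (there (there (here refl))) (All.map agree X-not-halves)) v∈Y)
    where
    agree : ∀ {u} → τ u ≢ halves → column (τ u) 0 ≡ column (τ u) 2
    agree {u} τu≢halves with τ u
    ... | flat   = refl
    ... | halves = contradiction refl τu≢halves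
    ... | parity = refl
    row0≢row2 : column (τ v) 0 ≢ column (τ v) 2
    row0≢row2 rewrite τv≡halves = λ ()

identityTeam : Team
identityTeam = record
  { entries  = ((λ v → v) , 1ℚ) ∷ []
  ; positive = toWitness {a? = 0ℚ ℚ.<? 1ℚ} _ ∷ []
  ; total    = refl
  }

identityTeam-fd : ∀ X Y → Sat identityTeam (fd X Y)
identityTeam-fd X Y _ _ (here refl) (here refl) _ = All.tabulate λ _ → refl

mass-identityTeam : ∀ u a → mass identityTeam u a ≡ (if does (u ≟ a) then 1ℚ else 0ℚ)
mass-identityTeam u a with does (u ≟ a)
... | true  = refl
... | false = refl

identityTeam-umde : ∀ u v → Sat identityTeam (umde u v)
identityTeam-umde u v = subst₂ _↭_ (sym (point-profile u)) (sym (point-profile v)) ↭-refl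
  where
  point-profile : ∀ u → map (mass identityTeam u) (values identityTeam u) ≡ 1ℚ ∷ []
  point-profile u rewrite mass-identityTeam u u | dec-true (u ≟ u) refl = refl

identityTeam-¬umi : ∀ {u v} → u ≢ v → ¬ Sat identityTeam (umi u v)
identityTeam-¬umi {u} {v} u≢v u≈v with u≈v u
... | mass≡ rewrite mass-identityTeam u u | mass-identityTeam v u
                  | dec-true (u ≟ u) refl | dec-false (v ≟ u) (≢-sym u≢v) with () ← mass≡

_[_↦_] : (Var → Shape) → Var → Shape → Var → Shape
(τ [ u ↦ s ]) v = if does (v ≟ u) then s else τ v

[↦]-same : ∀ τ u s → (τ [ u ↦ s ]) u ≡ s
[↦]-same τ u s rewrite dec-true (u ≟ u) refl = refl

[↦]-other : ∀ τ {u v} s → v ≢ u → (τ [ u ↦ s ]) v ≡ τ v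
[↦]-other τ {u} {v} s v≢u rewrite dec-false (v ≟ u) v≢u = refl

[↦]-preimage : ∀ τ {u v s} → τ v ≢ s → (τ [ u ↦ s ]) v ≡ s → v ≡ u
[↦]-preimage τ {u} {v} τv≢s τ'v≡s with v ≟ u
... | yes v≡u = v≡u
... | no v≢u  = contradiction (trans (sym ([↦]-other τ _ v≢u)) τ'v≡s) τv≢s

flatIf : Bool → Shape
flatIf true  = flat
flatIf false = parity

flatIf≢halves : ∀ b → flatIf b ≢ halves
flatIf≢halves true  ()
flatIf≢halves false ()

flatIf-< : ∀ ε h → flatIf (does (ε <? suc h)) ≡ flat ⊎ flatIf (does (ε <? suc h)) ≡ flatIf (does (ε <? h))
flatIf-< ε h with ε <? suc h
... | yes ε<1+h rewrite dec-true (ε <? suc h) ε<1+h = inj₁ refl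
... | no ε≮1+h rewrite dec-false (ε <? suc h) ε≮1+h | dec-false (ε <? h) (ε≮1+h ∘ m<n⇒m<1+n) = inj₂ refl

spike : Var → Var → Shape
spike v = (λ _ → flat) [ v ↦ halves ]

spike-separates : ∀ {u v} → u ≢ v → isFlat (spike u u) ≢ isFlat (spike u v)
spike-separates {u} {v} u≢v rewrite [↦]-same (λ _ → flat) u halves | [↦]-other (λ _ → flat) halves (≢-sym u≢v) = λ ()

block : ℕ → Var → Shape
block i v = if does (varIndex v ≟ i) then halves else parity

block-self : ∀ v → block (varIndex v) v ≡ halves
block-self v rewrite dec-true (varIndex v ≟ varIndex v) refl = refl

block-other : ∀ {i v} → varIndex v ≢ i → block i v ≡ parity
block-other {i} {v} vᵢ≢i rewrite dec-false (varIndex v ≟ i) vᵢ≢i = refl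

block-halves⁻ : ∀ i {v} → block i v ≡ halves → varIndex v ≡ i
block-halves⁻ i {v} eq with varIndex v ≟ i
... | yes vᵢ≡i = vᵢ≡i
... | no vᵢ≢i with () ← trans (sym (block-other vᵢ≢i)) eq

isFlat-block : ∀ i v → isFlat (block i v) ≡ false
isFlat-block i v with varIndex v ≟ i
... | yes vᵢ≡i rewrite dec-true (varIndex v ≟ i) vᵢ≡i = refl
... | no vᵢ≢i rewrite block-other vᵢ≢i = refl

module Cycle (m : ℕ) where

  n : ℕ
  n = suc m

  next : ℕ → ℕ
  next i = suc i % n

  next-< : ∀ i → next i < n
  next-< i = m%n<n (suc i) n

  next-inner : ∀ {i} → suc i < n → next i ≡ suc i
  next-inner = m<n⇒m%n≡m

  next-last : next m ≡ 0
  next-last = n%n≡0 n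

  fdLink umdeLink : ℕ → Atom
  fdLink i = fd (x⟨ i ⟩ ∷ []) (y⟨ i ⟩ ∷ [])
  umdeLink i = umde y⟨ i ⟩ x⟨ next i ⟩

  links : ℕ → List Atom
  links zero = []
  links (suc i) = fdLink i ∷ umdeLink i ∷ links i

  ∈-links⁺ : ∀ {i k} → i < k → fdLink i ∈ links k × umdeLink i ∈ links k
  ∈-links⁺ {i} {suc k} i<1+k with m≤n⇒m<n∨m≡n (≤-pred i<1+k)
  ... | inj₂ refl = here refl , there (here refl)
  ... | inj₁ i<k = let fd∈ , umde∈ = ∈-links⁺ i<k in there (there fd∈) , there (there umde∈)

  ∈-links⁻ : ∀ {δ k} → δ ∈ links k → ∃[ i ] i < k × (δ ≡ fdLink i ⊎ δ ≡ umdeLink i)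
  ∈-links⁻ {k = suc k} (here refl) = k , ≤-refl , inj₁ refl
  ∈-links⁻ {k = suc k} (there (here refl)) = k , ≤-refl , inj₂ refl
  ∈-links⁻ {k = suc k} (there (there δ∈)) with i , i<k , δ≡ ← ∈-links⁻ δ∈ = i , m≤n⇒m≤1+n i<k , δ≡

  Γ : List Atom
  Γ = links n

  σ : Atom
  σ = fd (y⟨ 0 ⟩ ∷ []) (x⟨ 0 ⟩ ∷ [])

  cyclic-antitone : (f : ℕ → ℕ) → (∀ {i} → i < n → f (next i) ≤ f i) → f 0 ≤ f (next 0)
  cyclic-antitone f step = begin
    f 0        ≡⟨ cong f next-last ⟨
    f (next m) ≤⟨ step ≤-refl ⟩
    f m        ≤⟨ antitone (≤-pred (next-< 0)) ≤-refl ⟩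
    f (next 0) ∎
    where
    open ≤-Reasoning
    antitone : ∀ {i j} → i ≤ j → j < n → f j ≤ f i
    antitone {j = zero} z≤n _ = ≤-refl
    antitone {i} {suc j} i≤1+j 1+j<n with m≤n⇒m<n∨m≡n i≤1+j
    ... | inj₂ refl = ≤-refl
    ... | inj₁ i<1+j = ≤-trans (subst (λ k → f k ≤ f j) (next-inner 1+j<n) (step (<-trans (n<1+n j) 1+j<n)))
                                (antitone (≤-pred i<1+j) (<-trans (n<1+n j) 1+j<n))

  Γ⊨σ : Γ ⊨ σ
  Γ⊨σ T ⊨Γ = fd-converse x⟨ 0 ⟩ y⟨ 0 ⟩ T (sat-fdLink 0<n) (begin
    f 0              ≤⟨ cyclic-antitone f step ⟩
    f (next 0)       ≡⟨ umde⇒#values≡ T _ _ (sat-umdeLink 0<n) ⟨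
    #values T y⟨ 0 ⟩ ∎)
    where
    open ≤-Reasoning
    0<n : 0 < n
    0<n = s≤s z≤n
    sat-fdLink : ∀ {i} → i < n → Sat T (fdLink i)
    sat-fdLink i<n = All.lookup ⊨Γ (proj₁ (∈-links⁺ i<n))
    sat-umdeLink : ∀ {i} → i < n → Sat T (umdeLink i)
    sat-umdeLink i<n = All.lookup ⊨Γ (proj₂ (∈-links⁺ i<n))
    f : ℕ → ℕ
    f i = #values T x⟨ i ⟩
    step : ∀ {i} → i < n → f (next i) ≤ f i
    step {i} i<n = subst (_≤ f i) (umde⇒#values≡ T _ _ (sat-umdeLink i<n)) (fd⇒#values≤ x⟨ i ⟩ y⟨ i ⟩ T (sat-fdLink i<n))

  FdLink UmdeLink : Var → Var → Set
  FdLink   u v = ∃[ i ] i < n × u ≡ x⟨ i ⟩ × v ≡ y⟨ i ⟩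
  UmdeLink u v = ∃[ i ] i < n × u ≡ y⟨ i ⟩ × v ≡ x⟨ next i ⟩

  Basic : Atom → Set
  Basic (umi u v)  = u ≡ v
  Basic (umde u v) = u ≡ v ⊎ UmdeLink u v ⊎ UmdeLink v u
  Basic (fd X Y)   = All (λ v → v ∈ X ⊎ Any (λ u → FdLink u v) X) Y

  Γ-basic : ∀ {δ} → δ ∈ Γ → Basic δ
  Γ-basic δ∈Γ with ∈-links⁻ δ∈Γ
  ... | i , i<n , inj₁ refl = inj₂ (here (i , i<n , refl , refl)) ∷ []
  ... | i , i<n , inj₂ refl = inj₂ (inj₁ (i , i<n , refl , refl))

  σ-not-basic : ¬ Basic σ
  σ-not-basic (inj₁ (here x₀≡y₀) ∷ [])               = x≢y 0 0 x₀≡y₀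
  σ-not-basic (inj₂ (here (i , _ , y₀≡xᵢ , _)) ∷ []) = x≢y i 0 (sym y₀≡xᵢ)

  -- The index of the only UMDE link an atom can coincide with.
  linkIndex : Atom → ℕ
  linkIndex (umde u v) = if varSide u then varIndex u else varIndex v
  linkIndex _          = 0

  module WithoutLink (j : ℕ) (j<n : j < n) where

    UsesLink : Atom → Set
    UsesLink δ = δ ≡ umde y⟨ j ⟩ x⟨ next j ⟩ ⊎ δ ≡ umde x⟨ next j ⟩ y⟨ j ⟩

    linkIndex-UsesLink : ∀ {δ} → UsesLink δ → linkIndex δ ≡ j
    linkIndex-UsesLink (inj₁ refl) rewrite varSide-var j true        = varIndex-var j true
    linkIndex-UsesLink (inj₂ refl) rewrite varSide-var (next j) false = varIndex-var j true

    Models : Team → Set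
    Models T = ∀ δ → Basic δ → ¬ UsesLink δ → Sat T δ

    Refuted : Atom → Set
    Refuted δ = Σ[ T ∈ Team ] Models T × ¬ Sat T δ

    -- Cutting the cycle at link j lays the indices out on a path next j, next (next j), …, j;
    -- pos is the position on that path.
    pos : ℕ → ℕ
    pos i with j <? i
    ... | yes _ = i ∸ suc j
    ... | no _  = n ∸ suc j + i

    pos-above : ∀ {i} → j < i → pos i ≡ i ∸ suc j
    pos-above {i} j<i with j <? i
    ... | yes _   = refl
    ... | no j≮i = contradiction j<i j≮i

    pos-below : ∀ {i} → ¬ j < i → pos i ≡ n ∸ suc j + i
    pos-below {i} j≮i with j <? i
    ... | yes j<i = contradiction j<i j≮i
    ... | no _    = refl

    n∸[1+j]+[1+j]≡n : n ∸ suc j + suc j ≡ n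
    n∸[1+j]+[1+j]≡n = m∸n+n≡m j<n

    pos-< : ∀ {i} → i < n → pos i < n
    pos-< {i} i<n with j <? i
    ... | yes j<i = ≤-<-trans (m∸n≤m i (suc j)) i<n
    ... | no j≮i  = subst (n ∸ suc j + i <_) n∸[1+j]+[1+j]≡n (+-monoʳ-< (n ∸ suc j) (s≤s (≮⇒≥ j≮i)))

    suc-pos-j : suc (pos j) ≡ n
    suc-pos-j rewrite pos-below (<-irrefl refl) = trans (sym (+-suc (n ∸ suc j) j)) n∸[1+j]+[1+j]≡n

    above<below : ∀ {i} → j < i → i < n → ∀ i' → i ∸ suc j < n ∸ suc j + i'
    above<below {i} j<i i<n i' = <-≤-trans (∸-monoˡ-< i<n j<i) (m≤m+n (n ∸ suc j) i')

    pos-injective : ∀ {i i'} → i < n → i' < n → pos i ≡ pos i' → i ≡ i'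
    pos-injective {i} {i'} i<n i'<n eq with j <? i | j <? i'
    ... | yes j<i | yes j<i' = begin
      i                  ≡⟨ m∸n+n≡m j<i ⟨
      i ∸ suc j + suc j  ≡⟨ cong (_+ suc j) eq ⟩
      i' ∸ suc j + suc j ≡⟨ m∸n+n≡m j<i' ⟩
      i'                 ∎
      where open ≡-Reasoning
    ... | no _    | no _     = +-cancelˡ-≡ (n ∸ suc j) i i' eq
    ... | yes j<i | no _     = contradiction (above<below j<i i<n i') (<-irrefl eq)
    ... | no _    | yes j<i' = contradiction (above<below j<i' i'<n i) (<-irrefl (sym eq))

    pos-next : ∀ {i} → i < n → i ≢ j → pos (next i) ≡ suc (pos i)
    pos-next {i} i<n i≢j with <-cmp i j
    ... | tri≈ _ i≡j _ = contradiction i≡j i≢j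
    ... | tri< i<j _ _ = begin
      pos (next i)        ≡⟨ cong pos (next-inner (≤-<-trans i<j j<n)) ⟩
      pos (suc i)         ≡⟨ pos-below (<⇒≱ i<j ∘ ≤-pred) ⟩
      n ∸ suc j + suc i   ≡⟨ +-suc (n ∸ suc j) i ⟩
      suc (n ∸ suc j + i) ≡⟨ cong suc (pos-below (<⇒≱ i<j ∘ <⇒≤)) ⟨
      suc (pos i)         ∎
      where open ≡-Reasoning
    ... | tri> _ _ j<i with m≤n⇒m<n∨m≡n i<n
    ...   | inj₁ 1+i<n = begin
      pos (next i)        ≡⟨ cong pos (next-inner 1+i<n) ⟩
      pos (suc i)         ≡⟨ pos-above (m<n⇒m<1+n j<i) ⟩
      suc i ∸ suc j       ≡⟨ +-∸-assoc 1 j<i ⟩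
      suc (i ∸ suc j)     ≡⟨ cong suc (pos-above j<i) ⟨
      suc (pos i)         ∎
      where open ≡-Reasoning
    ...   | inj₂ refl = begin
      pos (next m)        ≡⟨ cong pos next-last ⟩
      pos 0               ≡⟨ pos-below (λ ()) ⟩
      n ∸ suc j + 0       ≡⟨ +-identityʳ (n ∸ suc j) ⟩
      suc m ∸ suc j       ≡⟨ +-∸-assoc 1 j<i ⟩
      suc (m ∸ suc j)     ≡⟨ cong suc (pos-above j<i) ⟨
      suc (pos m)         ∎
      where open ≡-Reasoning

    -- Heights go up by one along an FD link and agree along every UMDE link other than j.
    height : Var → ℕ
    height v = if varSide v then suc (pos (varIndex v)) else pos (varIndex v)

    y-x-same-height : ∀ {i i'} → i < n → i' < n → suc (pos i) ≡ pos i' → UmdeLink y⟨ i ⟩ x⟨ i' ⟩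
    y-x-same-height {i} {i'} i<n i'<n eq with i ≟ j
    ... | yes refl = contradiction (subst (_< n) (sym eq) (pos-< i'<n)) (<-irrefl suc-pos-j)
    ... | no i≢j   = i , i<n , refl , cong x⟨_⟩ (sym (pos-injective (next-< i) i'<n (trans (pos-next i<n i≢j) eq)))

    same-height : ∀ {u v} → varIndex u < n → varIndex v < n → height u ≡ height v →
      u ≡ v ⊎ UmdeLink u v ⊎ UmdeLink v u
    same-height {u} {v} uᵢ<n vᵢ<n eq =
      subst₂ (λ u v → u ≡ v ⊎ UmdeLink u v ⊎ UmdeLink v u) (var-varIndex-varSide u) (var-varIndex-varSide v)
        (by-side (varSide u) (varSide v) eq)
      where
      by-side : ∀ b b' → (if b then suc (pos (varIndex u)) else pos (varIndex u)) ≡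
                         (if b' then suc (pos (varIndex v)) else pos (varIndex v)) →
        var (varIndex u) b ≡ var (varIndex v) b' ⊎
        UmdeLink (var (varIndex u) b) (var (varIndex v) b') ⊎ UmdeLink (var (varIndex v) b') (var (varIndex u) b)
      by-side false false eq = inj₁ (cong x⟨_⟩ (pos-injective uᵢ<n vᵢ<n eq))
      by-side true  true  eq = inj₁ (cong y⟨_⟩ (pos-injective uᵢ<n vᵢ<n (suc-injective eq)))
      by-side true  false eq = inj₂ (inj₁ (y-x-same-height uᵢ<n vᵢ<n eq))
      by-side false true  eq = inj₂ (inj₂ (y-x-same-height vᵢ<n uᵢ<n (sym eq)))

    threshold : ℕ → Var → Shape
    threshold ε v = if does (varIndex v <? n) then flatIf (does (ε <? height v)) else flat

    threshold-on-cycle : ∀ ε {v} → varIndex v < n → threshold ε v ≡ flatIf (does (ε <? height v))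
    threshold-on-cycle ε {v} vᵢ<n rewrite dec-true (varIndex v <? n) vᵢ<n = refl

    threshold≢halves : ∀ ε v → threshold ε v ≢ halves
    threshold≢halves ε v with varIndex v <? n
    ... | yes vᵢ<n rewrite threshold-on-cycle ε vᵢ<n = flatIf≢halves _
    ... | no vᵢ≮n rewrite dec-false (varIndex v <? n) vᵢ≮n = λ ()

    threshold-separates : ∀ {u v} → varIndex u < n → varIndex v < n → height u < height v →
      isFlat (threshold (height u) u) ≢ isFlat (threshold (height u) v)
    threshold-separates {u} {v} uᵢ<n vᵢ<n hu<hv
      rewrite threshold-on-cycle (height u) uᵢ<n | threshold-on-cycle (height u) vᵢ<n
            | dec-false (height u <? height u) (<-irrefl refl) | dec-true (height u <? height v) hu<hv = λ ()

    x-on-cycle : ∀ {i} → i < n → varIndex x⟨ i ⟩ < n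
    x-on-cycle {i} = subst (_< n) (sym (varIndex-var i false))

    y-on-cycle : ∀ {i} → i < n → varIndex y⟨ i ⟩ < n
    y-on-cycle {i} = subst (_< n) (sym (varIndex-var i true))

    height-x : ∀ i → height x⟨ i ⟩ ≡ pos i
    height-x i rewrite varSide-var i false | varIndex-var i false = refl

    height-y : ∀ i → height y⟨ i ⟩ ≡ suc (pos i)
    height-y i rewrite varSide-var i true | varIndex-var i true = refl

    record Respects (τ : Var → Shape) : Set where
      field
        fd-links   : ∀ {i} → i < n → τ y⟨ i ⟩ ≡ flat ⊎ τ y⟨ i ⟩ ≡ τ x⟨ i ⟩
        umde-links : ∀ {i} → i < n → i ≢ j → isFlat (τ y⟨ i ⟩) ≡ isFlat (τ x⟨ next i ⟩)

    grid-models : ∀ {τ} → Respects τ → Models (gridTeam τ)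
    grid-models {τ} resp = models
      where
      open Respects resp
      models : Models (gridTeam τ)
      models (umi u v) refl _ = λ _ → refl
      models (umde u v) (inj₁ refl) _ = grid-umde τ refl
      models (umde u v) (inj₂ (inj₁ (i , i<n , refl , refl))) ¬uses =
        grid-umde τ (umde-links i<n λ { refl → ¬uses (inj₁ refl) })
      models (umde u v) (inj₂ (inj₂ (i , i<n , refl , refl))) ¬uses =
        grid-umde τ (sym (umde-links i<n λ { refl → ¬uses (inj₂ refl) }))
      models (fd X Y) basic _ =
        fd-from-links (gridTeam τ) (λ { (i , i<n , refl , refl) → grid-fd₁ τ (fd-links i<n) }) basic

    identity-models : Models identityTeam
    identity-models (umi u v) refl _ = λ _ → refl
    identity-models (umde u v) _ _   = identityTeam-umde u v
    identity-models (fd X Y) _ _     = identityTeam-fd X Y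

    spike-respects : ∀ {v} → n ≤ varIndex v → Respects (spike v)
    spike-respects {v} n≤vᵢ = record
      { fd-links   = λ i<n → inj₁ (flat-on-cycle (y-on-cycle i<n))
      ; umde-links = λ i<n _ → cong isFlat (trans (flat-on-cycle (y-on-cycle i<n))
                                                  (sym (flat-on-cycle (x-on-cycle (next-< _)))))
      }
      where
      flat-on-cycle : ∀ {u} → varIndex u < n → spike v u ≡ flat
      flat-on-cycle {u} uᵢ<n = [↦]-other (λ _ → flat) {v} {u} halves (λ { refl → <⇒≱ uᵢ<n n≤vᵢ })

    block-respects : ∀ i → Respects (block i)
    block-respects i = record
      { fd-links   = λ {i'} _ → inj₂ (cong (λ k → if does (k ≟ i) then halves else parity)
                                           (trans (varIndex-var i' true) (sym (varIndex-var i' false))))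
      ; umde-links = λ {i'} _ _ → trans (isFlat-block i y⟨ i' ⟩) (sym (isFlat-block i x⟨ next i' ⟩))
      }

    threshold-same-height : ∀ ε {u v} → varIndex u < n → varIndex v < n → height u ≡ height v →
      threshold ε u ≡ threshold ε v
    threshold-same-height ε uᵢ<n vᵢ<n hu≡hv rewrite threshold-on-cycle ε uᵢ<n | threshold-on-cycle ε vᵢ<n | hu≡hv = refl

    threshold-respects : ∀ ε → Respects (threshold ε)
    threshold-respects ε = record
      { fd-links   = λ {i} i<n → subst₂ (λ ty tx → ty ≡ flat ⊎ ty ≡ tx)
          (sym (trans (threshold-on-cycle ε (y-on-cycle i<n)) (cong (flatIf ∘ does ∘ (ε <?_)) (height-y i))))
          (sym (trans (threshold-on-cycle ε (x-on-cycle i<n)) (cong (flatIf ∘ does ∘ (ε <?_)) (height-x i))))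
          (flatIf-< ε (pos i))
      ; umde-links = λ {i} i<n i≢j → cong isFlat (threshold-same-height ε (y-on-cycle i<n) (x-on-cycle (next-< i))
          (trans (height-y i) (trans (sym (pos-next i<n i≢j)) (sym (height-x (next i))))))
      }

    pinned : ℕ → Var → Shape
    pinned i = threshold (pos i) [ x⟨ i ⟩ ↦ halves ]

    pinned-respects : ∀ {i} → i < n → Respects (pinned i)
    pinned-respects {i} i<n = record { fd-links = fd-links ; umde-links = umde-links }
      where
      open Respects (threshold-respects (pos i)) renaming (fd-links to fd-links′; umde-links to umde-links′)
      at-y : ∀ i' → pinned i y⟨ i' ⟩ ≡ threshold (pos i) y⟨ i' ⟩
      at-y i' = [↦]-other (threshold (pos i)) halves (≢-sym (x≢y i i'))
      at-x : ∀ {i'} → i' ≢ i → pinned i x⟨ i' ⟩ ≡ threshold (pos i) x⟨ i' ⟩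
      at-x i'≢i = [↦]-other (threshold (pos i)) halves (i'≢i ∘ x⟨⟩-injective)
      fd-links : ∀ {i'} → i' < n → pinned i y⟨ i' ⟩ ≡ flat ⊎ pinned i y⟨ i' ⟩ ≡ pinned i x⟨ i' ⟩
      fd-links {i'} i'<n rewrite at-y i' with i' ≟ i
      ... | yes refl rewrite threshold-on-cycle (pos i) (y-on-cycle i<n) | height-y i
                           | dec-true (pos i <? suc (pos i)) ≤-refl = inj₁ refl
      ... | no i'≢i rewrite at-x i'≢i = fd-links′ i'<n
      umde-links : ∀ {i'} → i' < n → i' ≢ j → isFlat (pinned i y⟨ i' ⟩) ≡ isFlat (pinned i x⟨ next i' ⟩)
      umde-links {i'} i'<n i'≢j rewrite at-y i' with next i' ≟ i
      ... | yes refl rewrite [↦]-same (threshold (pos (next i'))) x⟨ next i' ⟩ halves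
                           | threshold-on-cycle (pos (next i')) (y-on-cycle i'<n) | height-y i' | pos-next i'<n i'≢j
                           = cong isFlat (cong flatIf (dec-false (suc (pos i') <? suc (pos i')) (<-irrefl refl)))
      ... | no next≢i rewrite at-x next≢i = umde-links′ i'<n i'≢j

    refute-umde : ∀ {τ u v} → Respects τ → isFlat (τ u) ≢ isFlat (τ v) → Refuted (umde u v)
    refute-umde {τ} resp separated = gridTeam τ , grid-models resp , separated ∘ grid-umde⁻ τ

    refute-fd : ∀ {τ X v} → Respects τ → τ v ≡ halves → All (λ u → τ u ≢ halves) X → Refuted (fd X (v ∷ []))
    refute-fd {τ} resp τv≡halves X-not-halves =
      gridTeam τ , grid-models resp , grid-¬fd τ (here refl) τv≡halves X-not-halves

    classify-umde : ∀ u v → Basic (umde u v) ⊎ Refuted (umde u v)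
    classify-umde u v with u ≟ v
    ... | yes u≡v = inj₁ (inj₁ u≡v)
    ... | no u≢v with varIndex u <? n | varIndex v <? n
    ...   | no uᵢ≮n | _ = inj₂ (refute-umde (spike-respects (≮⇒≥ uᵢ≮n)) (spike-separates u≢v))
    ...   | yes _ | no vᵢ≮n =
      inj₂ (refute-umde (spike-respects (≮⇒≥ vᵢ≮n)) (≢-sym (spike-separates (≢-sym u≢v))))
    ...   | yes uᵢ<n | yes vᵢ<n with <-cmp (height u) (height v)
    ...     | tri≈ _ hu≡hv _ = inj₁ (same-height uᵢ<n vᵢ<n hu≡hv)
    ...     | tri< hu<hv _ _ = inj₂ (refute-umde (threshold-respects _) (threshold-separates uᵢ<n vᵢ<n hu<hv))
    ...     | tri> _ _ hv<hu =
      inj₂ (refute-umde (threshold-respects _) (≢-sym (threshold-separates vᵢ<n uᵢ<n hv<hu)))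

    refute-by-block : ∀ {X v} → x⟨ varIndex v ⟩ ∉ X → y⟨ varIndex v ⟩ ∉ X → Refuted (fd X (v ∷ []))
    refute-by-block {X} {v} x∉X y∉X =
      refute-fd (block-respects (varIndex v)) (block-self v) (All.tabulate not-halves)
      where
      not-halves : ∀ {u} → u ∈ X → block (varIndex v) u ≢ halves
      not-halves {u} u∈X is-halves with x-or-y u | block-halves⁻ (varIndex v) {u} is-halves
      ... | inj₁ u≡x | uᵢ≡vᵢ = x∉X (subst (_∈ X) (trans u≡x (cong x⟨_⟩ uᵢ≡vᵢ)) u∈X)
      ... | inj₂ u≡y | uᵢ≡vᵢ = y∉X (subst (_∈ X) (trans u≡y (cong y⟨_⟩ uᵢ≡vᵢ)) u∈X)

    classify-target : ∀ X v → (v ∈ X ⊎ Any (λ u → FdLink u v) X) ⊎ Refuted (fd X (v ∷ []))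
    classify-target X v with v ∈? X
    ... | yes v∈X = inj₁ (inj₁ v∈X)
    ... | no v∉X with varIndex v <? n
    ...   | no vᵢ≮n = inj₂ (refute-fd (spike-respects (≮⇒≥ vᵢ≮n)) ([↦]-same (λ _ → flat) v halves)
                              (All.tabulate λ u∈X is-halves → v∉X (subst (_∈ X) ([↦]-preimage (λ _ → flat) (λ ()) is-halves) u∈X)))
    ...   | yes vᵢ<n with x-or-y v
    ...     | inj₂ v≡y with x⟨ varIndex v ⟩ ∈? X
    ...       | yes x∈X = inj₁ (inj₂ (Any.map (λ { refl → varIndex v , vᵢ<n , refl , v≡y }) x∈X))
    ...       | no x∉X  = inj₂ (refute-by-block x∉X (v∉X ∘ subst (_∈ X) (sym v≡y)))
    classify-target X v | no v∉X | yes vᵢ<n | inj₁ v≡x with y⟨ varIndex v ⟩ ∈? X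
    ...       | no y∉X  = inj₂ (refute-by-block (v∉X ∘ subst (_∈ X) (sym v≡x)) y∉X)
    ...       | yes _   = inj₂ (refute-fd (pinned-respects vᵢ<n)
                              (trans (cong (pinned (varIndex v)) v≡x) ([↦]-same τ x⟨ varIndex v ⟩ halves))
                              (All.tabulate λ {u} u∈X is-halves →
                                v∉X (subst (_∈ X) (trans ([↦]-preimage τ (threshold≢halves _ u) is-halves) (sym v≡x)) u∈X)))
      where τ = threshold (pos (varIndex v))

    classify-fd : ∀ X Y → Basic (fd X Y) ⊎ Refuted (fd X Y)
    classify-fd X [] = inj₁ []
    classify-fd X (v ∷ Y) with classify-target X v | classify-fd X Y
    ... | inj₂ (T , ⊨T , ¬X→v) | _                  = inj₂ (T , ⊨T , ¬X→v ∘ proj₁ ∘ fd-∷⁻ T)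
    ... | inj₁ _               | inj₂ (T , ⊨T , ¬X→Y) = inj₂ (T , ⊨T , ¬X→Y ∘ proj₂ ∘ fd-∷⁻ T)
    ... | inj₁ v-basic         | inj₁ Y-basic          = inj₁ (v-basic ∷ Y-basic)

    classify : ∀ δ → Basic δ ⊎ Refuted δ
    classify (umi u v) with u ≟ v
    ... | yes u≡v = inj₁ u≡v
    ... | no u≢v  = inj₂ (identityTeam , identity-models , identityTeam-¬umi u≢v)
    classify (umde u v) = classify-umde u v
    classify (fd X Y)   = classify-fd X Y

  basic-closed : ∀ {r prem concl} → Sound r → KAry m r → r (prem , concl) → All Basic prem → All Basic concl
  basic-closed {r} {prem} {concl} sound arity inst prem-basic
    with j , j<n , j∉ ← ∃∉-below n (map linkIndex prem)
                          (s≤s (subst (_≤ m) (sym (length-map linkIndex prem)) (arity prem concl inst)))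
    = All.tabulate conclusion-basic
    where
    open WithoutLink j j<n
    conclusion-basic : ∀ {δ} → δ ∈ concl → Basic δ
    conclusion-basic {δ} δ∈ with classify δ
    ... | inj₁ δ-basic = δ-basic
    ... | inj₂ (T , ⊨T , ¬δ) = contradiction (All.lookup (sound prem concl inst T (All.tabulate sat-premise)) δ∈) ¬δ
      where
      sat-premise : ∀ {p} → p ∈ prem → Sat T p
      sat-premise p∈ = ⊨T _ (All.lookup prem-basic p∈)
        (λ uses → j∉ (subst (_∈ map linkIndex prem) (linkIndex-UsesLink uses) (∈-map⁺ linkIndex p∈)))

  module _ (Ax : Axiomatization) (Ax-ok : ∀ r → Ax r → Sound r × KAry m r) where

    derivable⇒basic : ∀ {δ} → Derivable Ax Γ δ → Basic δ
    all-derivable⇒basic : ∀ {δs} → All (Derivable Ax Γ) δs → All Basic δs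

    derivable⇒basic (hyp δ∈Γ) = Γ-basic δ∈Γ
    derivable⇒basic (app r r∈Ax prem concl inst premises δ∈concl) =
      All.lookup (basic-closed (proj₁ (Ax-ok r r∈Ax)) (proj₂ (Ax-ok r r∈Ax)) inst
                               (all-derivable⇒basic premises)) δ∈concl

    all-derivable⇒basic []       = []
    all-derivable⇒basic (d ∷ ds) = derivable⇒basic d ∷ all-derivable⇒basic ds

theorem3p16 : (k : ℕ) (Ax : Axiomatization) →
    (∀ r → Ax r → Sound r × KAry k r) →
    Σ[ Γ ∈ List Atom ] Σ[ σ ∈ Atom ] ((Γ ⊨ σ) × ¬ Derivable Ax Γ σ)
theorem3p16 k Ax Ax-ok = Γ , σ , Γ⊨σ , σ-not-basic ∘ derivable⇒basic Ax Ax-ok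
  where open Cycle k
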